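{- Let $p$ be a prime and $\chi:U_1\to\mathbb{Z}/p^2\mathbb{Z}$ a character of type $\langle 2,m\rangle$ with standard expansion $\chi=x_1\mathfrak{Z}_1+x_2\mathfrak{Z}_2+\sum_{1\le j\le m,\,p\nmid j}a_j\,p\,\mathfrak{Z}_j$. Let $u(t)=t(1+\alpha t+\beta t^2+\cdots)\in\mathfrak{N}$ with $\alpha,\beta\in\mathbb{F}_p$. Then: (a) ${}_u\chi(E_1)\equiv x_1+\alpha x_2\pmod p$ and ${}_u\chi(E_2)\equiv x_2\pmod p$; (b) if $p\nmid m$, then ${}_u\chi(E_m)\equiv p\,a_m\pmod{p^2}$; (c) if $m\not\equiv0,1\pmod p$, then ${}_u\chi(E_{m-1})\equiv p\,(a_{m-1}+(m-1)\alpha a_m)\pmod{p^2}$; (d) if $m\equiv0\pmod p$, so that $m=2p$, then ${}_u\chi(E_{m-1})\equiv p\,(a_{m-1}+\eta x_2)\pmod{p^2}$, where $\eta\in\mathbb{F}_p$ satisfies $\eta^p=(m-1)\alpha$.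
   Context: $K=\mathbb{F}_p((t))$, $\mathfrak{M}=t\mathbb{F}_p[[t]]$, $U_1=1+\mathfrak{M}$. The Nottingham group $\mathfrak{N}$ is $\{tz:z\in U_1\}$ under composition; it acts on continuous characters $\chi:U_1\to\mathbb{Z}/p^n\mathbb{Z}$ by ${}_w\chi(f(t))=\chi(f\circ w(t))$. Break sequence of a surjective character $\chi:U_1\to\mathbb{Z}/p^n\mathbb{Z}$: $b^{(j)}$ is the largest integer $b$ for which some $z\in1+\mathfrak{M}^b$ has $\chi(z)=p^j$. A character of type $\langle2,m\rangle$ is a surjective continuous $\chi:U_1\to\mathbb{Z}/p^2\mathbb{Z}$ with break sequence $\langle2,m\rangle$ (forcing $p$ odd, $m\ge 2p$, $m=2p$ if $p\mid m$). For $p\nmid j$, $E_j=1+t^j$ (a topological $\mathbb{Z}_p$-basis of $U_1$) and $\mathfrak{Z}_j$ the dual characters, $\mathfrak{Z}_i(E_j)=\delta_{ij}$. The standard expansion of $\chi$ is the unique expression $\chi=x_1\mathfrak{Z}_1+x_2\mathfrak{Z}_2+\sum_{1\le j\le m,\,p\nmid j}a_j p\mathfrak{Z}_j$ with $x_1,x_2,a_j\in\{0,\dots,p-1\}$, $x_2\ne0$, $a_m\ne0$ if $p\nmid m$; coefficients are also viewed as elements of $\mathbb{F}_p$. -}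

module Defs where

open import Data.Nat using (ℕ; zero; suc; _+_; _*_; _∸_; _^_; _≤_; _<_; NonZero)
open import Data.Nat.DivMod using (_mod_)
open import Data.Nat.Divisibility using (_∣_)
open import Data.Fin using (Fin; toℕ)
open import Data.Integer using (ℤ; +_; _-_)
import Data.Integer.Divisibility as ℤDiv
open import Data.Bool using (if_then_else_)
open import Data.Nat using (_≡ᵇ_)
open import Data.Product using (Σ; ∃; _×_)
open import Relation.Binary.PropositionalEquality using (_≡_)
open import Relation.Nullary using (¬_)

Cong : ℕ → ℕ → ℕ → Set
Cong n a b = (+ n) ℤDiv.∣ ((+ a) - (+ b))

Σ≤ : ℕ → (ℕ → ℕ) → ℕ
Σ≤ zero    f = f zero
Σ≤ (suc n) f = Σ≤ n f + f (suc n)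

-- formal power series over 𝔽_p = Fin p  (coefficient of t^i)
Series : ℕ → Set
Series p = ℕ → Fin p

module _ (p : ℕ) .{{_ : NonZero p}} where

  one : Series p
  one i = (if i ≡ᵇ 0 then 1 else 0) mod p

  mul : Series p → Series p → Series p
  mul f g n = Σ≤ n (λ i → toℕ (f i) * toℕ (g (n ∸ i))) mod p

  pow : Series p → ℕ → Series p
  pow z zero    = one
  pow z (suc k) = mul (pow z k) z

  -- f ∘ (t z):  coefficient n is  Σ_{k ≤ n} f_k (z^k)_{n-k}
  compose : Series p → Series p → Series p
  compose f z n = Σ≤ n (λ k → toℕ (f k) * toℕ (pow z k (n ∸ k))) mod p

  E : ℕ → Series p
  E j i = (if i ≡ᵇ 0 then 1 else (if i ≡ᵇ j then 1 else 0)) mod p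

InU1 : {p : ℕ} → Series p → Set
InU1 f = toℕ (f 0) ≡ 1

InU : {p : ℕ} → ℕ → Series p → Set
InU b f = InU1 f × (∀ i → 1 ≤ i → i < b → toℕ (f i) ≡ 0)

module _ (p : ℕ) .{{_ : NonZero p}} where

  -- χ : U_1 → ℤ/p²ℤ, values represented by natural numbers modulo p²
  -- (values of χ outside U_1 are irrelevant)
  IsHom : (Series p → ℕ) → Set
  IsHom χ = ∀ f g → InU1 f → InU1 g →
            Cong (p ^ 2) (χ (mul p f g)) (χ f + χ g)

  IsContinuous : (Series p → ℕ) → Set
  IsContinuous χ = ∃ λ N → ∀ f g → InU1 f → InU1 g →
                   (∀ i → i < N → f i ≡ g i) → Cong (p ^ 2) (χ f) (χ g)

  IsSurjective : (Series p → ℕ) → Set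
  IsSurjective χ = ∀ k → k < p ^ 2 → ∃ λ z → InU1 z × Cong (p ^ 2) (χ z) k

  Attained : (Series p → ℕ) → ℕ → ℕ → Set
  Attained χ j b = ∃ λ z → InU b z × Cong (p ^ 2) (χ z) (p ^ j)

  IsBreak : (Series p → ℕ) → ℕ → ℕ → Set
  IsBreak χ j b = Attained χ j b × (∀ b′ → b < b′ → ¬ Attained χ j b′)

  IsType2m : (Series p → ℕ) → ℕ → Set
  IsType2m χ m = IsHom χ × IsContinuous χ × IsSurjective χ
               × IsBreak χ 0 2 × IsBreak χ 1 m

  -- χ = x₁𝔷₁ + x₂𝔷₂ + Σ_{1≤j≤m, p∤j} a_j p 𝔷_j is the standard expansion of χ
  -- (a continuous character is determined by its values on the topological
  --  basis E_j, p ∤ j, and 𝔷_i(E_j) = δ_ij)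
  StdExpansion : (Series p → ℕ) → ℕ → ℕ → ℕ → (ℕ → ℕ) → Set
  StdExpansion χ m x₁ x₂ a =
      x₁ < p × x₂ < p × (∀ j → a j < p) × ¬ (x₂ ≡ 0)
    × (¬ (p ∣ m) → ¬ (a m ≡ 0))
    × Cong (p ^ 2) (χ (E p 1)) (x₁ + p * a 1)
    × Cong (p ^ 2) (χ (E p 2)) (x₂ + p * a 2)
    × (∀ j → 3 ≤ j → j ≤ m → ¬ (p ∣ j) → Cong (p ^ 2) (χ (E p j)) (p * a j))
    × (∀ j → m < j → ¬ (p ∣ j) → Cong (p ^ 2) (χ (E p j)) 0)

module Submission where

-- Two consequences of the break sequence carry the argument (module Character):
-- b⁽¹⁾ = m makes χ vanish on 1 + 𝔐^(m+1), so series agreeing modulo t^(m+1) have equal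
-- values; b⁽⁰⁾ = 2 gives χ(1 + 𝔐³) ⊆ pℤ/p²ℤ, so series agreeing modulo t³ have equal
-- values modulo p.  Both rely on division by units in 𝔽_p[[t]] (f = g w with w ∈ 1 + 𝔐ᵇ
-- when f ≡ g mod tᵇ).  On the series side (module PowerSeries) the key facts are the shift
-- lemma  E_j(u) ≡ (1 + j α t^(j+1)) E_j  (mod t^(j+2)),  the congruence 1 + c tⁿ ≡ Eₙᶜ
-- (mod t^(n+1)) and Frobenius (1 + c tᵈ)ᵖ ≡ 1 + cᵖ t^(pd) (mod t^(pd+1)), the last two
-- from the binomial theorem and p ∣ (p C i) for 0 < i < p.  Taking j = 1, 2, m, m - 1 in
-- the shift lemma gives parts (a)–(d); for (d) the breaks also force m = 2p.

open import Defs
open import Data.Nat using (ℕ; _+_; _*_; _∸_; _^_; _<_; NonZero)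
open import Data.Nat.Divisibility using (_∣_)
open import Data.Nat.Primality using (Prime)
open import Data.Fin using (toℕ)
open import Data.Product using (_×_)
open import Relation.Nullary using (¬_)

open import Data.Nat
open import Data.Nat.Properties
open import Data.Nat.DivMod
open import Data.Nat.Divisibility
open import Data.Nat.GCD using (gcd[m,n]∣m; gcd[m,n]∣n; module Bézout)
open import Data.Nat.Coprimality using (Coprime; coprime-Bézout; coprime-divisor; gcd≡1⇒coprime)
open import Data.Nat.Primality
open import Data.Nat.Combinatorics using (_C_; nCk≡n!/k![n-k]!; k![n∸k]!∣n!; nC1≡n; nCn≡1; nCk+nC[k+1]≡[n+1]C[k+1])
open import Data.Nat.Solver using (module +-*-Solver)
open import Data.Fin using (Fin)
open import Data.Fin.Properties using (toℕ-injective; toℕ<n; toℕ-fromℕ<)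
import Data.Integer as ℤ
import Data.Integer.Properties as ℤ
open import Data.Product
open import Data.Sum
open import Data.Empty
open import Data.Unit using (tt)
open import Function using (_∘_)
open import Data.Bool using (true; false; if_then_else_; T)
open import Relation.Nullary
open import Relation.Binary.PropositionalEquality
open import Relation.Binary.Definitions using (tri<; tri≈; tri>)

infix 4 _≡_[mod_]
_≡_[mod_] : ℕ → ℕ → (n : ℕ) .{{_ : NonZero n}} → Set
a ≡ b [mod n ] = a % n ≡ b % n

module Congruence {n : ℕ} .{{_ : NonZero n}} where

  ≡mod-+ : ∀ {a a′ b b′} → a ≡ a′ [mod n ] → b ≡ b′ [mod n ] → a + b ≡ a′ + b′ [mod n ]
  ≡mod-+ {a} {a′} {b} {b′} e f = begin
    (a + b) % n             ≡⟨ %-distribˡ-+ a b n ⟩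
    (a % n + b % n) % n     ≡⟨ cong₂ (λ x y → (x + y) % n) e f ⟩
    (a′ % n + b′ % n) % n   ≡⟨ %-distribˡ-+ a′ b′ n ⟨
    (a′ + b′) % n           ∎
    where open ≡-Reasoning

  ≡mod-* : ∀ {a a′ b b′} → a ≡ a′ [mod n ] → b ≡ b′ [mod n ] → a * b ≡ a′ * b′ [mod n ]
  ≡mod-* {a} {a′} {b} {b′} e f = begin
    (a * b) % n               ≡⟨ %-distribˡ-* a b n ⟩
    (a % n * (b % n)) % n     ≡⟨ cong₂ (λ x y → (x * y) % n) e f ⟩
    (a′ % n * (b′ % n)) % n   ≡⟨ %-distribˡ-* a′ b′ n ⟨
    (a′ * b′) % n             ∎
    where open ≡-Reasoning

  %-≡mod : ∀ a → a % n ≡ a [mod n ]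
  %-≡mod a = m%n%n≡m%n a n

  private
    0%n≡0 : 0 % n ≡ 0
    0%n≡0 = m<n⇒m%n≡m (>-nonZero⁻¹ n)

  multiple-≡mod-0 : ∀ k → k * n ≡ 0 [mod n ]
  multiple-≡mod-0 k = trans (m*n%n≡0 k n) (sym 0%n≡0)

  modulus-≡mod-0 : n ≡ 0 [mod n ]
  modulus-≡mod-0 = trans (n%n≡0 n) (sym 0%n≡0)

  -- cancellation: add n ∸ (c mod n) to both sides, which cancels c
  ≡mod-+-cancelʳ : ∀ {a b c} → a + c ≡ b + c [mod n ] → a ≡ b [mod n ]
  ≡mod-+-cancelʳ {a} {b} {c} e = begin
    a % n                   ≡⟨ undo a ⟨
    (a + c + c′) % n        ≡⟨ ≡mod-+ {a + c} {b + c} {c′} e refl ⟩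
    (b + c + c′) % n        ≡⟨ undo b ⟩
    b % n                   ∎
    where
    open ≡-Reasoning
    c′ : ℕ
    c′ = n ∸ c % n
    c+c′≡0 : c + c′ ≡ 0 [mod n ]
    c+c′≡0 = begin
      (c + c′) % n       ≡⟨ ≡mod-+ {c} {c % n} {c′} (sym (%-≡mod c)) refl ⟩
      (c % n + c′) % n   ≡⟨ cong (_% n) (m+[n∸m]≡n (m%n≤n c n)) ⟩
      n % n              ≡⟨ modulus-≡mod-0 ⟩
      0 % n              ∎
    undo : ∀ x → x + c + c′ ≡ x [mod n ]
    undo x = begin
      (x + c + c′) % n    ≡⟨ cong (_% n) (+-assoc x c c′) ⟩
      (x + (c + c′)) % n  ≡⟨ ≡mod-+ {x} refl c+c′≡0 ⟩
      (x + 0) % n         ≡⟨ cong (_% n) (+-identityʳ x) ⟩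
      x % n               ∎

  ≡mod⇒∣∸ : ∀ {a b} → b ≤ a → a ≡ b [mod n ] → n ∣ a ∸ b
  ≡mod⇒∣∸ {a} {b} b≤a e = divides (a / n ∸ b / n) (begin
    a ∸ b                                         ≡⟨ cong₂ _∸_ (m≡m%n+[m/n]*n a n) (m≡m%n+[m/n]*n b n) ⟩
    (a % n + a / n * n) ∸ (b % n + b / n * n)     ≡⟨ cong (λ r → (r + a / n * n) ∸ (b % n + b / n * n)) e ⟩
    (b % n + a / n * n) ∸ (b % n + b / n * n)     ≡⟨ [m+n]∸[m+o]≡n∸o (b % n) _ _ ⟩
    a / n * n ∸ b / n * n                         ≡⟨ *-distribʳ-∸ n (a / n) (b / n) ⟨
    (a / n ∸ b / n) * n                           ∎)
    where open ≡-Reasoning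

  ∣∸⇒≡mod : ∀ {a b} → b ≤ a → n ∣ a ∸ b → a ≡ b [mod n ]
  ∣∸⇒≡mod {a} {b} b≤a (divides q eq) = begin
    a % n              ≡⟨ cong (_% n) (m∸n+n≡m b≤a) ⟨
    (a ∸ b + b) % n    ≡⟨ cong (λ d → (d + b) % n) eq ⟩
    (q * n + b) % n    ≡⟨ cong (_% n) (+-comm (q * n) b) ⟩
    (b + q * n) % n    ≡⟨ [m+kn]%n≡m%n b q n ⟩
    b % n              ∎
    where open ≡-Reasoning

  -- the congruence Cong used in the statement is divisibility of the integer a - b,
  -- whose absolute value is a ∸ b or b ∸ a
  private
    ∣a-b∣≡a∸b : ∀ {a b} → b ≤ a → ℤ.∣ ℤ.+ a ℤ.- ℤ.+ b ∣ ≡ a ∸ b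
    ∣a-b∣≡a∸b {a} {b} b≤a =
      trans (cong ℤ.∣_∣ (ℤ.[+m]-[+n]≡m⊖n a b)) (trans (ℤ.∣m⊖n∣≡∣n⊖m∣ a b) (ℤ.∣⊖∣-≤ b≤a))
    ∣a-b∣≡b∸a : ∀ {a b} → a ≤ b → ℤ.∣ ℤ.+ a ℤ.- ℤ.+ b ∣ ≡ b ∸ a
    ∣a-b∣≡b∸a {a} {b} a≤b = trans (cong ℤ.∣_∣ (ℤ.[+m]-[+n]≡m⊖n a b)) (ℤ.∣⊖∣-≤ a≤b)

  Cong⇒≡mod : ∀ {a b} → Cong n a b → a ≡ b [mod n ]
  Cong⇒≡mod {a} {b} c with ≤-total b a
  ... | inj₁ b≤a = ∣∸⇒≡mod b≤a (subst (n ∣_) (∣a-b∣≡a∸b b≤a) c)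
  ... | inj₂ a≤b = sym (∣∸⇒≡mod a≤b (subst (n ∣_) (∣a-b∣≡b∸a a≤b) c))

  ≡mod⇒Cong : ∀ {a b} → a ≡ b [mod n ] → Cong n a b
  ≡mod⇒Cong {a} {b} e with ≤-total b a
  ... | inj₁ b≤a = subst (n ∣_) (sym (∣a-b∣≡a∸b b≤a)) (≡mod⇒∣∸ b≤a e)
  ... | inj₂ a≤b = subst (n ∣_) (sym (∣a-b∣≡b∸a a≤b)) (≡mod⇒∣∸ a≤b (sym e))

  ≡mod-∣ : ∀ d .{{_ : NonZero d}} → d ∣ n → ∀ {a b} → a ≡ b [mod n ] → a ≡ b [mod d ]
  ≡mod-∣ d d∣n {a} {b} e =
    trans (sym (m∣n⇒o%n%m≡o%m d n a d∣n)) (trans (cong (_% d) e) (m∣n⇒o%n%m≡o%m d n b d∣n))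

  ≡mod-scale : ∀ k .{{_ : NonZero (n * k)}} {a b} → a ≡ b [mod n ] → a * k ≡ b * k [mod n * k ]
  ≡mod-scale k {a} {b} e =
    trans (sym (m%n*o≡m*o%[n*o] a n k)) (trans (cong (_* k) e) (m%n*o≡m*o%[n*o] b n k))

open Congruence public

coprime-* : ∀ {a b n} → Coprime a n → Coprime b n → Coprime (a * b) n
coprime-* {a} {b} a⊥n b⊥n {d} (d∣ab , d∣n) = b⊥n (coprime-divisor d⊥a d∣ab , d∣n)
  where
  d⊥a : Coprime d a
  d⊥a = gcd≡1⇒coprime (a⊥n (gcd[m,n]∣n d a , ∣-trans (gcd[m,n]∣m d a) d∣n))

inverse : ∀ {n v} .{{_ : NonZero n}} → Coprime n v → ∃ λ u → u * v ≡ 1 [mod n ]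
inverse {n} {v} n⊥v with coprime-Bézout n⊥v
... | Bézout.-+ x y eq = y , trans (cong (_% n) (sym eq)) ([m+kn]%n≡m%n 1 x n)
... | Bézout.+- x y eq = (n ∸ 1) * y , ≡mod-+-cancelʳ (trans uv+[n-1]≡0 (sym 1+[n-1]≡0))
  where
  open ≡-Reasoning
  open +-*-Solver
  uv+[n-1]≡0 : (n ∸ 1) * y * v + (n ∸ 1) ≡ 0 [mod n ]
  uv+[n-1]≡0 = begin
    ((n ∸ 1) * y * v + (n ∸ 1)) % n
      ≡⟨ cong (_% n) (solve 3 (λ k y v → k :* y :* v :+ k := k :* (con 1 :+ y :* v)) refl (n ∸ 1) y v) ⟩
    ((n ∸ 1) * (1 + y * v)) % n       ≡⟨ cong (λ w → ((n ∸ 1) * w) % n) eq ⟩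
    ((n ∸ 1) * (x * n)) % n           ≡⟨ cong (_% n) (*-assoc (n ∸ 1) x n) ⟨
    ((n ∸ 1) * x * n) % n             ≡⟨ multiple-≡mod-0 ((n ∸ 1) * x) ⟩
    0 % n                             ∎
  1+[n-1]≡0 : 1 + (n ∸ 1) ≡ 0 [mod n ]
  1+[n-1]≡0 = trans (cong (_% n) (m+[n∸m]≡n (>-nonZero⁻¹ n))) (modulus-≡mod-0 {n})

n∣n! : ∀ n .{{_ : NonZero n}} → n ∣ n !
n∣n! (suc k) = m∣m*n (k !)

module Primes {p : ℕ} (isPrime : Prime p) where

  instance
    p≢0 : NonZero p
    p≢0 = prime⇒nonZero isPrime

  1<p : 1 < p
  1<p = nonTrivial⇒n>1 p {{prime⇒nonTrivial isPrime}}

  ∤⇒coprime : ∀ {v} → ¬ p ∣ v → Coprime p v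
  ∤⇒coprime p∤v {d} (d∣p , d∣v) with prime⇒irreducible isPrime d∣p
  ... | inj₁ d≡1 = d≡1
  ... | inj₂ refl = ⊥-elim (p∤v d∣v)

  ∤factorial : ∀ {k} → k < p → ¬ p ∣ k !
  ∤factorial {zero} _ p∣1 = <⇒≢ 1<p (sym (∣1⇒≡1 p∣1))
  ∤factorial {suc k} k<p p∣[k+1]! with euclidsLemma (suc k) (k !) isPrime p∣[k+1]!
  ... | inj₁ p∣k+1 = <⇒≱ k<p (∣⇒≤ p∣k+1)
  ... | inj₂ p∣k! = ∤factorial (<-trans (n<1+n k) k<p) p∣k!

  ∣binomial : ∀ {i} → 0 < i → i < p → p ∣ p C i
  ∣binomial {i} 0<i i<p with euclidsLemma (p C i) (i ! * (p ∸ i) !) isPrime p∣C·D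
    where
    instance
      D≢0 : NonZero (i ! * (p ∸ i) !)
      D≢0 = i !* (p ∸ i) !≢0
    -- (p C i) · i! (p - i)! = p!, which p divides; p divides neither i! nor (p - i)!
    p∣C·D : p ∣ (p C i) * (i ! * (p ∸ i) !)
    p∣C·D = subst (p ∣_) (sym C·D≡p!) (n∣n! p)
      where
      C·D≡p! : (p C i) * (i ! * (p ∸ i) !) ≡ p !
      C·D≡p! = trans (cong (_* (i ! * (p ∸ i) !)) (nCk≡n!/k![n-k]! (<⇒≤ i<p)))
                     (m/n*n≡m (k![n∸k]!∣n! (<⇒≤ i<p)))
  ... | inj₁ p∣C = p∣C
  ... | inj₂ p∣D = ⊥-elim ([ ∤factorial i<p , ∤factorial (∸-monoʳ-< 0<i (<⇒≤ i<p)) ]′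
                             (euclidsLemma (i !) ((p ∸ i) !) isPrime p∣D))

  instance
    p²≢0 : NonZero (p ^ 2)
    p²≢0 = m^n≢0 p 2

  p∣p² : p ∣ p ^ 2
  p∣p² = m∣m*n (p * 1)

  p≢0[mod-p²] : ¬ (p ≡ 0 [mod p ^ 2 ])
  p≢0[mod-p²] p≡0 = <⇒≢ 0<p (sym (begin
    p            ≡⟨ m<n⇒m%n≡m p<p² ⟨
    p % p ^ 2    ≡⟨ p≡0 ⟩
    0 % p ^ 2    ≡⟨ m<n⇒m%n≡m (<-trans 0<p p<p²) ⟩
    0            ∎))
    where
    open ≡-Reasoning
    0<p : 0 < p
    0<p = <-trans z<s 1<p
    p<p² : p < p ^ 2
    p<p² = subst (_< p * (p * 1)) (*-identityʳ p) (*-monoʳ-< p (subst (1 <_) (sym (*-identityʳ p)) 1<p))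

  scale-by-p : ∀ {a b} → a ≡ b [mod p ] → p * a ≡ p * b [mod p ^ 2 ]
  scale-by-p {a} {b} e = begin
    (p * a) % p ^ 2          ≡⟨ cong (_% p ^ 2) (p*x≡x*p′ a) ⟩
    (a * (p * 1)) % p ^ 2    ≡⟨ ≡mod-scale (p * 1) e ⟩
    (b * (p * 1)) % p ^ 2    ≡⟨ cong (_% p ^ 2) (p*x≡x*p′ b) ⟨
    (p * b) % p ^ 2          ∎
    where
    open ≡-Reasoning
    p*x≡x*p′ : ∀ x → p * x ≡ x * (p * 1)
    p*x≡x*p′ x = trans (*-comm p x) (cong (x *_) (sym (*-identityʳ p)))

  inverse-mod-p² : ∀ {v} → ¬ p ∣ v → ∃ λ u → u * v ≡ 1 [mod p ^ 2 ]
  inverse-mod-p² {v} p∤v = inverse (coprime-* p⊥v (coprime-* p⊥v λ (d∣1 , _) → ∣1⇒≡1 d∣1))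
    where
    p⊥v : Coprime p v
    p⊥v = ∤⇒coprime p∤v

  p·unit : ∀ {w} → w ≡ 1 [mod p ] → p * w ≡ p [mod p ^ 2 ]
  p·unit w≡1 = trans (scale-by-p w≡1) (cong (_% p ^ 2) (*-identityʳ p))

  multiple-≡p : ∀ {v} → ¬ (v ≡ 0 [mod p ^ 2 ]) → ∃ λ u → u * v ≡ p [mod p ^ 2 ]
  multiple-≡p {v} v≢0 with p ∣? v
  ... | no p∤v = let u , uv≡1 = inverse (∤⇒coprime p∤v) in
                 p * u , trans (cong (_% p ^ 2) (*-assoc p u v)) (p·unit uv≡1)
  ... | yes (divides q refl) with p ∣? q
  ...   | no p∤q = let u , uq≡1 = inverse (∤⇒coprime p∤q) in
                   u , trans (cong (_% p ^ 2) (trans (sym (*-assoc u q p)) (*-comm (u * q) p))) (p·unit uq≡1)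
  ...   | yes (divides r refl) = ⊥-elim (v≢0 (trans (cong (_% p ^ 2) r·p·p≡r·p²) (multiple-≡mod-0 r)))
    where
    r·p·p≡r·p² : r * p * p ≡ r * p ^ 2
    r·p·p≡r·p² = trans (*-assoc r p p) (cong (λ x → r * (p * x)) (sym (*-identityʳ p)))

module Sums where

  Σ-cong : ∀ n {f g : ℕ → ℕ} → (∀ i → i ≤ n → f i ≡ g i) → Σ≤ n f ≡ Σ≤ n g
  Σ-cong zero    f≡g = f≡g 0 z≤n
  Σ-cong (suc n) f≡g = cong₂ _+_ (Σ-cong n (λ i i≤n → f≡g i (m≤n⇒m≤1+n i≤n))) (f≡g (suc n) ≤-refl)

  Σ-≡mod : ∀ {d} .{{_ : NonZero d}} n {f g : ℕ → ℕ} →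
           (∀ i → i ≤ n → f i ≡ g i [mod d ]) → Σ≤ n f ≡ Σ≤ n g [mod d ]
  Σ-≡mod zero    f≡g = f≡g 0 z≤n
  Σ-≡mod (suc n) f≡g = ≡mod-+ (Σ-≡mod n (λ i i≤n → f≡g i (m≤n⇒m≤1+n i≤n))) (f≡g (suc n) ≤-refl)

  Σ-first : ∀ n (f : ℕ → ℕ) → Σ≤ (suc n) f ≡ f 0 + Σ≤ n (λ i → f (suc i))
  Σ-first zero    f = refl
  Σ-first (suc n) f = trans (cong (_+ f (suc (suc n))) (Σ-first n f)) (+-assoc (f 0) _ _)

  Σ-reverse : ∀ n (f : ℕ → ℕ) → Σ≤ n f ≡ Σ≤ n (λ j → f (n ∸ j))
  Σ-reverse zero    f = refl
  Σ-reverse (suc n) f = trans (+-comm (Σ≤ n f) (f (suc n)))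
    (trans (cong (f (suc n) +_) (Σ-reverse n f)) (sym (Σ-first n (λ j → f (suc n ∸ j)))))

  Σ-zero : ∀ n {f : ℕ → ℕ} → (∀ i → i ≤ n → f i ≡ 0) → Σ≤ n f ≡ 0
  Σ-zero zero    f≡0 = f≡0 0 z≤n
  Σ-zero (suc n) f≡0 = cong₂ _+_ (Σ-zero n (λ i i≤n → f≡0 i (m≤n⇒m≤1+n i≤n))) (f≡0 (suc n) ≤-refl)

  Σ-single : ∀ n k {f : ℕ → ℕ} → k ≤ n → (∀ i → i ≤ n → i ≢ k → f i ≡ 0) → Σ≤ n f ≡ f k
  Σ-single zero .zero z≤n _ = refl
  Σ-single (suc n) k {f} k≤1+n f≡0 with k ≟ suc n
  ... | yes refl = cong (_+ f (suc n)) (Σ-zero n (λ i i≤n → f≡0 i (m≤n⇒m≤1+n i≤n) (λ { refl → 1+n≰n i≤n })))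
  ... | no k≢1+n = trans (cong₂ _+_ (Σ-single n k (≤-pred (≤∧≢⇒< k≤1+n k≢1+n)) (λ i i≤n → f≡0 i (m≤n⇒m≤1+n i≤n)))
                                    (f≡0 (suc n) ≤-refl (≢-sym k≢1+n)))
                         (+-identityʳ (f k))

  -- guard d n x = [d ≤ n] x; it writes coefficient formulas containing x_(n - d) without
  -- relying on truncated subtraction
  guard : ℕ → ℕ → ℕ → ℕ
  guard zero    n       x = x
  guard (suc d) zero    x = 0
  guard (suc d) (suc n) x = guard d n x

  guard-yes : ∀ {d n} x → d ≤ n → guard d n x ≡ x
  guard-yes x z≤n = refl
  guard-yes x (s≤s d≤n) = guard-yes x d≤n

  guard-no : ∀ {d n} x → n < d → guard d n x ≡ 0
  guard-no {suc d} {zero} x _ = refl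
  guard-no {suc d} {suc n} x (s≤s n<d) = guard-no x n<d

  guard-≡mod : ∀ {m} .{{_ : NonZero m}} d n {x y} → x ≡ y [mod m ] → guard d n x ≡ guard d n y [mod m ]
  guard-≡mod zero    n       x≡y = x≡y
  guard-≡mod (suc d) zero    x≡y = refl
  guard-≡mod (suc d) (suc n) x≡y = guard-≡mod d n x≡y

  δ : ℕ → ℕ → ℕ → ℕ
  δ k c i = if i ≡ᵇ k then c else 0

  δ-off : ∀ {k} c {i} → i ≢ k → δ k c i ≡ 0
  δ-off {k} c {i} i≢k with i ≡ᵇ k in eq
  ... | false = refl
  ... | true  = ⊥-elim (i≢k (≡ᵇ⇒≡ i k (subst T (sym eq) tt)))

  δ-on : ∀ k c → δ k c k ≡ c
  δ-on zero    c = refl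
  δ-on (suc k) c = δ-on k c

  Σ-δ : ∀ n k c (F : ℕ → ℕ) → Σ≤ n (λ i → δ k c i * F i) ≡ guard k n (c * F k)
  Σ-δ n k c F with k ≤? n
  ... | yes k≤n = trans (Σ-single n k k≤n (λ i _ i≢k → cong (_* F i) (δ-off {k} c {i} i≢k)))
                        (trans (cong (_* F k) (δ-on k c)) (sym (guard-yes (c * F k) k≤n)))
  ... | no k≰n = trans (Σ-zero n (λ i i≤n → cong (_* F i) (δ-off {k} c {i} (λ { refl → k≰n i≤n }))))
                       (sym (guard-no (c * F k) (≰⇒> k≰n)))

module PowerSeries {p : ℕ} (isPrime : Prime p) where

  open Sums
  open Primes isPrime using (p≢0; 1<p; ∣binomial)

  coeff : Series p → ℕ → ℕ
  coeff f i = toℕ (f i)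

  coeff-mod : ∀ a → toℕ (a mod p) ≡ a [mod p ]
  coeff-mod a = trans (cong (_% p) (toℕ-fromℕ< (m%n<n a p))) (%-≡mod a)

  ≡mod⇒≡ : ∀ {x y : Fin p} → toℕ x ≡ toℕ y [mod p ] → x ≡ y
  ≡mod⇒≡ {x} {y} e = toℕ-injective (trans (sym (m<n⇒m%n≡m (toℕ<n x))) (trans e (m<n⇒m%n≡m (toℕ<n y))))

  ≡mod-value : ∀ {x : Fin p} {v} → toℕ x ≡ v [mod p ] → v < p → toℕ x ≡ v
  ≡mod-value {x} e v<p = trans (sym (m<n⇒m%n≡m (toℕ<n x))) (trans e (m<n⇒m%n≡m v<p))

  _≐_ : Series p → Series p → Set
  f ≐ g = ∀ i → f i ≡ g i

  Agree : ℕ → Series p → Series p → Set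
  Agree b f g = ∀ i → i < b → f i ≡ g i

  Agree-sym : ∀ {b f g} → Agree b f g → Agree b g f
  Agree-sym f≡g i i<b = sym (f≡g i i<b)

  Agree-trans : ∀ {b f g h} → Agree b f g → Agree b g h → Agree b f h
  Agree-trans f≡g g≡h i i<b = trans (f≡g i i<b) (g≡h i i<b)

  ≐⇒Agree : ∀ {b f g} → f ≐ g → Agree b f g
  ≐⇒Agree f≡g i _ = f≡g i

  Agree-weaken : ∀ {b b′ f g} → b′ ≤ b → Agree b f g → Agree b′ f g
  Agree-weaken b′≤b f≡g i i<b′ = f≡g i (<-≤-trans i<b′ b′≤b)

  Agree-extend : ∀ {b f g} → Agree b f g → f b ≡ g b → Agree (suc b) f g
  Agree-extend {b} f≡g fb≡gb i i<1+b with i ≟ b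
  ... | yes refl = fb≡gb
  ... | no i≢b = f≡g i (≤∧≢⇒< (≤-pred i<1+b) i≢b)

  Agree-coeff : ∀ b {f g} → (∀ i → i < b → coeff f i ≡ coeff g i [mod p ]) → Agree b f g
  Agree-coeff b f≡g i i<b = ≡mod⇒≡ (f≡g i i<b)

  Agree-mod : ∀ b {f} (v : ℕ → ℕ) → (∀ i → i < b → coeff f i ≡ v i [mod p ]) →
              Agree b f (λ i → v i mod p)
  Agree-mod b v f≡v i i<b = ≡mod⇒≡ (trans (f≡v i i<b) (sym (coeff-mod (v i))))

  coeff-one : ∀ i → coeff (one p) i ≡ δ 0 1 i [mod p ]
  coeff-one i = coeff-mod (δ 0 1 i)

  coeff-one-0 : coeff (one p) 0 ≡ 1
  coeff-one-0 = ≡mod-value (coeff-one 0) 1<p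

  coeff-one-suc : ∀ i → coeff (one p) (suc i) ≡ 0
  coeff-one-suc i = ≡mod-value (coeff-one (suc i)) (<-trans z<s 1<p)

  InU⇒Agree : ∀ {b} {w : Series p} → InU b w → Agree b w (one p)
  InU⇒Agree (w₀≡1 , _) zero _ = toℕ-injective (trans w₀≡1 (sym coeff-one-0))
  InU⇒Agree (_ , wᵢ≡0) (suc i) i<b = toℕ-injective (trans (wᵢ≡0 (suc i) (s≤s z≤n) i<b) (sym (coeff-one-suc i)))

  Agree⇒InU : ∀ {b} {w : Series p} → 1 ≤ b → Agree b w (one p) → InU b w
  Agree⇒InU 1≤b w≡1 = trans (cong toℕ (w≡1 0 1≤b)) coeff-one-0
                    , λ { zero () _ ; (suc i) _ i<b → trans (cong toℕ (w≡1 (suc i) i<b)) (coeff-one-suc i) }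

  InU⇒InU1 : ∀ {b} {w : Series p} → InU b w → InU1 w
  InU⇒InU1 = proj₁

  InU1⇒InU : ∀ {w : Series p} → InU1 w → InU 1 w
  InU1⇒InU w₀≡1 = w₀≡1 , λ { zero () _ ; (suc i) _ (s≤s ()) }

  mul-Agree : ∀ b {f f′ g g′} → Agree b f f′ → Agree b g g′ → Agree b (mul p f g) (mul p f′ g′)
  mul-Agree b f≡f′ g≡g′ n n<b = cong (_mod p) (Σ-cong n (λ i i≤n →
    cong₂ (λ x y → toℕ x * toℕ y) (f≡f′ i (≤-<-trans i≤n n<b)) (g≡g′ (n ∸ i) (≤-<-trans (m∸n≤m n i) n<b))))

  -- the product is commutative (reverse the convolution sum) and has unit 1
  mul-comm : ∀ f g → mul p f g ≐ mul p g f
  mul-comm f g n = cong (_mod p) (trans (Σ-reverse n _) (Σ-cong n λ i i≤n →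
    trans (cong (λ j → coeff f (n ∸ i) * coeff g j) (m∸[m∸n]≡n i≤n)) (*-comm (coeff f (n ∸ i)) (coeff g i))))

  one-mul : ∀ f → mul p (one p) f ≐ f
  one-mul f n = ≡mod⇒≡ (begin
    toℕ (mul p (one p) f n) % p                        ≡⟨ coeff-mod _ ⟩
    Σ≤ n (λ i → coeff (one p) i * coeff f (n ∸ i)) % p
      ≡⟨ Σ-≡mod n (λ i _ → ≡mod-* {a = coeff (one p) i} {b = coeff f (n ∸ i)} (coeff-one i) refl) ⟩
    Σ≤ n (λ i → δ 0 1 i * coeff f (n ∸ i)) % p
      ≡⟨ cong (_% p) (Σ-δ n 0 1 (λ i → coeff f (n ∸ i))) ⟩
    (1 * coeff f n) % p                                ≡⟨ cong (_% p) (*-identityˡ (coeff f n)) ⟩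
    coeff f n % p                                      ∎)
    where open ≡-Reasoning

  mul-InU : ∀ {b} {f g : Series p} → 1 ≤ b → InU b f → InU b g → InU b (mul p f g)
  mul-InU {b} 1≤b f∈U g∈U =
    Agree⇒InU 1≤b (Agree-trans (mul-Agree b (InU⇒Agree f∈U) (InU⇒Agree g∈U)) (≐⇒Agree (one-mul (one p))))

  pow-InU : ∀ {b} {f : Series p} k → 1 ≤ b → InU b f → InU b (pow p f k)
  pow-InU zero    1≤b _   = Agree⇒InU 1≤b (λ _ _ → refl)
  pow-InU (suc k) 1≤b f∈U = mul-InU 1≤b (pow-InU k 1≤b f∈U) f∈U

  mul-InU1 : ∀ {f g : Series p} → InU1 f → InU1 g → InU1 (mul p f g)
  mul-InU1 {f} {g} f∈U g∈U = proj₁ (mul-InU {1} {f} {g} ≤-refl (InU1⇒InU f∈U) (InU1⇒InU g∈U))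

  pow-InU1 : ∀ {f : Series p} k → InU1 f → InU1 (pow p f k)
  pow-InU1 {f} k f∈U = proj₁ (pow-InU {1} {f} k ≤-refl (InU1⇒InU f∈U))

  pow-coeff-1 : ∀ {z : Series p} k → InU1 z → coeff (pow p z k) 1 ≡ k * coeff z 1 [mod p ]
  pow-coeff-1 zero    _ = cong (_% p) (coeff-one-suc 0)
  pow-coeff-1 {z} (suc k) z₀≡1 = begin
    coeff (pow p z (suc k)) 1 % p                                        ≡⟨ coeff-mod _ ⟩
    (coeff (pow p z k) 0 * coeff z 1 + coeff (pow p z k) 1 * coeff z 0) % p
      ≡⟨ cong₂ (λ x y → (x * coeff z 1 + coeff (pow p z k) 1 * y) % p) (pow-InU1 k z₀≡1) z₀≡1 ⟩
    (1 * coeff z 1 + coeff (pow p z k) 1 * 1) % p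
      ≡⟨ cong₂ (λ x y → (x + y) % p) (*-identityˡ (coeff z 1)) (*-identityʳ _) ⟩
    (coeff z 1 + coeff (pow p z k) 1) % p
      ≡⟨ ≡mod-+ {a = coeff z 1} refl (pow-coeff-1 k z₀≡1) ⟩
    (coeff z 1 + k * coeff z 1) % p                                      ∎
    where open ≡-Reasoning

  -- the coefficients of 1 + c tᵈ as natural numbers, and the series itself;
  -- E j is definitionally B 1 j
  bv : ℕ → ℕ → ℕ → ℕ
  bv c d i = if i ≡ᵇ 0 then 1 else δ d c i

  B : ℕ → ℕ → Series p
  B c d i = bv c d i mod p

  bv-top : ∀ c {d} → 0 < d → bv c d d ≡ c
  bv-top c {suc d} _ = δ-on d c

  bv-mid : ∀ c {d i} → 0 < i → i ≢ d → bv c d i ≡ 0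
  bv-mid c {d} {suc i} _ i≢d = δ-off c i≢d

  bv-low : ∀ c {d i} → i < d → bv c d i ≡ δ 0 1 i
  bv-low c {i = zero}  _   = refl
  bv-low c {i = suc i} i<d = bv-mid c z<s (<⇒≢ i<d)

  coeff-B-top : ∀ c {d} → 0 < d → coeff (B c d) d ≡ c [mod p ]
  coeff-B-top c {d} 0<d = trans (coeff-mod (bv c d d)) (cong (_% p) (bv-top c 0<d))

  B-InU1 : ∀ c d → InU1 (B c d)
  B-InU1 c d = coeff-one-0

  B-Agree-one : ∀ c d → Agree d (B c d) (one p)
  B-Agree-one c d i i<d = cong (_mod p) (bv-low c i<d)

  B-cong : ∀ {c c′} d → c ≡ c′ [mod p ] → B c d ≐ B c′ d
  B-cong {c} {c′} d c≡c′ i with i ≡ᵇ 0 | i ≡ᵇ d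
  ... | true  | _     = refl
  ... | false | false = refl
  ... | false | true  = ≡mod⇒≡ (trans (coeff-mod c) (trans c≡c′ (sym (coeff-mod c′))))

  sparse-sum : ∀ n c {d} → 0 < d → (F : ℕ → ℕ) →
               Σ≤ n (λ k → coeff (B c d) k * F k) ≡ F 0 + guard d n (c * F d) [mod p ]
  sparse-sum n c {d} 0<d F = trans (Σ-≡mod n (λ k _ → ≡mod-* {a = coeff (B c d) k} {b = F k} (coeff-mod (bv c d k)) refl))
                                   (cong (_% p) (exact n d 0<d))
    where
    -- over ℕ: the term k = 0 is F 0, the remaining terms form a sum against δ_d
    exact : ∀ n d → 0 < d → Σ≤ n (λ k → bv c d k * F k) ≡ F 0 + guard d n (c * F d)
    exact zero    (suc d) _ = trans (+-identityʳ (F 0)) (sym (+-identityʳ (F 0)))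
    exact (suc n) (suc d) _ = trans (Σ-first n _)
      (cong₂ _+_ (+-identityʳ (F 0)) (Σ-δ n d c (λ i → F (suc i))))

  B-mul-coeff : ∀ c {d} → 0 < d → ∀ f n →
                coeff (mul p (B c d) f) n ≡ coeff f n + guard d n (c * coeff f (n ∸ d)) [mod p ]
  B-mul-coeff c 0<d f n = trans (coeff-mod _) (sparse-sum n c 0<d (λ k → coeff f (n ∸ k)))

  mul-B-coeff : ∀ c {d} → 0 < d → ∀ f n →
                coeff (mul p f (B c d)) n ≡ coeff f n + guard d n (c * coeff f (n ∸ d)) [mod p ]
  mul-B-coeff c {d} 0<d f n = trans (cong (λ x → toℕ x % p) (mul-comm f (B c d) n)) (B-mul-coeff c 0<d f n)

  bpow : ℕ → ℕ → ℕ → ℕ → ℕ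
  bpow c d zero    n = δ 0 1 n
  bpow c d (suc k) n = bpow c d k n + guard d n (c * bpow c d k (n ∸ d))

  -- bpow mirrors the recursion pow (B c d) (k + 1) = pow (B c d) k · B c d
  pow-B-coeff : ∀ c {d} → 0 < d → ∀ k n → coeff (pow p (B c d) k) n ≡ bpow c d k n [mod p ]
  pow-B-coeff c     0<d zero    n = coeff-one n
  pow-B-coeff c {d} 0<d (suc k) n = trans (mul-B-coeff c 0<d (pow p (B c d) k) n)
    (≡mod-+ {a = coeff (pow p (B c d) k) n} (pow-B-coeff c 0<d k n)
            (guard-≡mod d n (≡mod-* {a = c} refl (pow-B-coeff c 0<d k (n ∸ d)))))

  bpow-off : ∀ c d k i {r} → 0 < r → r < d → bpow c d k (r + i * d) ≡ 0
  bpow-off c d zero    i       {suc r} _ _ = refl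
  bpow-off c d (suc k) zero    {r} 0<r r<d =
    cong₂ _+_ (bpow-off c d k 0 0<r r<d) (guard-no _ (subst (_< d) (sym (+-identityʳ r)) r<d))
  bpow-off c d (suc k) (suc i) {r} 0<r r<d = cong₂ _+_ (bpow-off c d k (suc i) 0<r r<d) (begin
    guard d (r + suc i * d) (c * bpow c d k (r + suc i * d ∸ d))
      ≡⟨ guard-yes _ (≤-trans (m≤m+n d (i * d)) (m≤n+m _ r)) ⟩
    c * bpow c d k (r + suc i * d ∸ d)                          ≡⟨ cong (λ x → c * bpow c d k x) r+[d+id]∸d≡r+id ⟩
    c * bpow c d k (r + i * d)                                  ≡⟨ cong (c *_) (bpow-off c d k i 0<r r<d) ⟩
    c * 0                                                       ≡⟨ *-zeroʳ c ⟩
    0                                                           ∎)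
    where
    open ≡-Reasoning
    r+[d+id]∸d≡r+id : r + (d + i * d) ∸ d ≡ r + i * d
    r+[d+id]∸d≡r+id = trans (cong (_∸ d) (x+[y+z]≡y+[x+z] r d (i * d))) (m+n∸m≡n d (r + i * d))
      where
      x+[y+z]≡y+[x+z] : ∀ x y z → x + (y + z) ≡ y + (x + z)
      x+[y+z]≡y+[x+z] x y z = trans (sym (+-assoc x y z)) (trans (cong (_+ z) (+-comm x y)) (+-assoc y x z))

  bpow-on : ∀ c {d} → 0 < d → ∀ k i → bpow c d k (i * d) ≡ (k C i) * c ^ i
  bpow-on c     0<d zero    zero    = refl
  bpow-on c {d} 0<d zero    (suc i) = δ-off 1 (m+n≢0 i)
    where
    m+n≢0 : ∀ i → d + i * d ≢ 0
    m+n≢0 i d+id≡0 = <⇒≢ (<-≤-trans 0<d (m≤m+n d (i * d))) (sym d+id≡0)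
  bpow-on c     0<d (suc k) zero    = cong₂ _+_ (bpow-on c 0<d k 0) (guard-no _ 0<d)
  bpow-on c {d} 0<d (suc k) (suc i) = begin
    bpow c d k (d + i * d) + guard d (d + i * d) (c * bpow c d k (d + i * d ∸ d))
      ≡⟨ cong₂ _+_ (bpow-on c 0<d k (suc i)) (guard-yes _ (m≤m+n d (i * d))) ⟩
    (k C suc i) * c ^ suc i + c * bpow c d k (d + i * d ∸ d)
      ≡⟨ cong (λ n → (k C suc i) * c ^ suc i + c * bpow c d k n) (m+n∸m≡n d (i * d)) ⟩
    (k C suc i) * c ^ suc i + c * bpow c d k (i * d)
      ≡⟨ cong (λ x → (k C suc i) * c ^ suc i + c * x) (bpow-on c 0<d k i) ⟩
    (k C suc i) * (c * c ^ i) + c * ((k C i) * c ^ i)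
      ≡⟨ solve 4 (λ a b c x → a :* (c :* x) :+ c :* (b :* x) := (b :+ a) :* (c :* x)) refl (k C suc i) (k C i) c (c ^ i) ⟩
    ((k C i) + (k C suc i)) * (c * c ^ i)
      ≡⟨ cong (_* (c * c ^ i)) (nCk+nC[k+1]≡[n+1]C[k+1] k i) ⟩
    (suc k C suc i) * c ^ suc i
      ∎
    where
    open ≡-Reasoning
    open +-*-Solver

  pow-B-Agree : ∀ c {d} → 0 < d → ∀ k → Agree (suc d) (pow p (B c d) k) (B (k * c) d)
  pow-B-Agree c {d} 0<d k = Agree-mod (suc d) (bv (k * c) d) coeffs
    where
    coeffs : ∀ i → i < suc d → coeff (pow p (B c d) k) i ≡ bv (k * c) d i [mod p ]
    coeffs zero _ = trans (pow-B-coeff c 0<d k 0) (cong (_% p) (bpow-on c 0<d k 0))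
    coeffs (suc i) i<1+d with suc i ≟ d
    ... | yes refl = trans (pow-B-coeff c 0<d k (suc i)) (cong (_% p) (begin
      bpow c d k d             ≡⟨ cong (bpow c d k) (*-identityˡ d) ⟨
      bpow c d k (1 * d)       ≡⟨ bpow-on c 0<d k 1 ⟩
      (k C 1) * (c * 1)        ≡⟨ cong₂ _*_ (nC1≡n k) (*-identityʳ c) ⟩
      k * c                    ≡⟨ bv-top (k * c) 0<d ⟨
      bv (k * c) d d           ∎))
      where open ≡-Reasoning
    ... | no i+1≢d = trans (pow-B-coeff c 0<d k (suc i)) (cong (_% p) (trans
      (trans (cong (bpow c d k) (sym (+-identityʳ (suc i)))) (bpow-off c d k 0 z<s (≤∧≢⇒< (≤-pred i<1+d) i+1≢d)))
      (sym (bv-mid (k * c) {d} {suc i} z<s i+1≢d))))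

  frobenius : ∀ c {d} → 0 < d → Agree (suc (p * d)) (pow p (B c d) p) (B (c ^ p) (p * d))
  frobenius c {d} 0<d = Agree-mod (suc (p * d)) (bv (c ^ p) (p * d)) coeffs
    where
    instance
      d≢0 : NonZero d
      d≢0 = >-nonZero 0<d

    coeff-off : ∀ q {r} → 0 < r → r < d →
                coeff (pow p (B c d) p) (r + q * d) ≡ bv (c ^ p) (p * d) (r + q * d) [mod p ]
    coeff-off q {r} 0<r r<d = trans (pow-B-coeff c 0<d p (r + q * d)) (cong (_% p) (trans
      (bpow-off c d p q 0<r r<d) (sym (bv-mid (c ^ p) (<-≤-trans 0<r (m≤m+n r (q * d))) r+qd≢pd))))
      where
      r+qd≢pd : r + q * d ≢ p * d
      r+qd≢pd r+qd≡pd = <⇒≢ 0<r (sym (begin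
        r                  ≡⟨ m<n⇒m%n≡m r<d ⟨
        r % d              ≡⟨ [m+kn]%n≡m%n r q d ⟨
        (r + q * d) % d    ≡⟨ cong (_% d) r+qd≡pd ⟩
        (p * d) % d        ≡⟨ m*n%n≡0 p d ⟩
        0                  ∎))
        where open ≡-Reasoning

    -- at q d with q ≤ p: 1 for q = 0, cᵖ for q = p, and p ∣ (p C q) in between
    coeff-on : ∀ q → q ≤ p → coeff (pow p (B c d) p) (q * d) ≡ bv (c ^ p) (p * d) (q * d) [mod p ]
    coeff-on zero _ = trans (pow-B-coeff c 0<d p 0) (cong (_% p) (bpow-on c 0<d p 0))
    coeff-on (suc q) q<p with suc q ≟ p
    ... | yes refl = trans (pow-B-coeff c 0<d p (suc q * d)) (cong (_% p) (trans (bpow-on c 0<d (suc q) (suc q))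
                       (trans (cong (_* c ^ suc q) (nCn≡1 (suc q))) (trans (*-identityˡ _) (sym (bv-top (c ^ suc q) 0<qd))))))
      where
      0<qd : 0 < suc q * d
      0<qd = <-≤-trans 0<d (m≤m+n d (q * d))
    ... | no q+1≢p = trans (pow-B-coeff c 0<d p (suc q * d)) (trans (cong (_% p) (bpow-on c 0<d p (suc q)))
                       (trans (∣∸⇒≡mod z≤n (∣-trans (∣binomial z<s (≤∧≢⇒< q<p q+1≢p)) (m∣m*n (c ^ suc q))))
                              (cong (_% p) (sym (bv-mid (c ^ p) (<-≤-trans 0<d (m≤m+n d (q * d)))
                                 (λ qd≡pd → q+1≢p (*-cancelʳ-≡ (suc q) p d qd≡pd)))))))

    -- dispatch by division with remainder, n = r + q d
    coeffs : ∀ n → n < suc (p * d) → coeff (pow p (B c d) p) n ≡ bv (c ^ p) (p * d) n [mod p ]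
    coeffs n n≤pd with n % d in n%d≡r
    ... | suc r = subst (λ n → coeff (pow p (B c d) p) n ≡ bv (c ^ p) (p * d) n [mod p ]) (sym n≡r+qd)
                    (coeff-off (n / d) z<s (subst (_< d) n%d≡r (m%n<n n d)))
      where
      n≡r+qd : n ≡ suc r + (n / d) * d
      n≡r+qd = trans (m≡m%n+[m/n]*n n d) (cong (_+ (n / d) * d) n%d≡r)
    ... | zero = subst (λ n → coeff (pow p (B c d) p) n ≡ bv (c ^ p) (p * d) n [mod p ]) (sym n≡qd)
                   (coeff-on (n / d) (*-cancelʳ-≤ (n / d) p d (subst (_≤ p * d) n≡qd (≤-pred n≤pd))))
      where
      n≡qd : n ≡ (n / d) * d
      n≡qd = trans (m≡m%n+[m/n]*n n d) (cong (_+ (n / d) * d) n%d≡r)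

  -- coefficients of E_j(u) = 1 + tʲ zʲ for u = t z:  δ₀ + [j ≤ n] (zʲ)_(n - j)
  compose-E-coeff : ∀ {j} → 0 < j → ∀ z n →
    coeff (compose p (E p j) z) n ≡ δ 0 1 n + guard j n (coeff (pow p z j) (n ∸ j)) [mod p ]
  compose-E-coeff {j} 0<j z n = begin
    coeff (compose p (E p j) z) n % p                                         ≡⟨ coeff-mod _ ⟩
    Σ≤ n (λ k → coeff (B 1 j) k * coeff (pow p z k) (n ∸ k)) % p              ≡⟨ sparse-sum n 1 0<j _ ⟩
    (coeff (one p) n + guard j n (1 * coeff (pow p z j) (n ∸ j))) % p
      ≡⟨ ≡mod-+ {a = coeff (one p) n} (coeff-one n) (cong (λ x → guard j n x % p) (*-identityˡ _)) ⟩
    (δ 0 1 n + guard j n (coeff (pow p z j) (n ∸ j))) % p                     ∎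
    where open ≡-Reasoning

  compose-E-InU1 : ∀ {j} → 0 < j → ∀ z → InU1 (compose p (E p j) z)
  compose-E-InU1 {j} 0<j z = ≡mod-value (trans (compose-E-coeff 0<j z 0) (cong (λ x → (1 + x) % p) (guard-no _ 0<j))) 1<p

  compose-E-Agree : ∀ {z} → InU1 z → ∀ {j} → 0 < j →
    Agree (2 + j) (compose p (E p j) z) (mul p (B (j * coeff z 1) (suc j)) (E p j))
  compose-E-Agree {z} z∈U {j} 0<j = Agree-coeff (2 + j) coeffs
    where
    α : ℕ
    α = coeff z 1
    L R : Series p
    L = compose p (E p j) z
    R = mul p (B (j * α) (suc j)) (E p j)
    -- E_j has coefficients bv 1 j, so R is computed by B-mul-coeff
    coeff-R : ∀ n → coeff R n ≡ bv 1 j n + guard (suc j) n (j * α * bv 1 j (n ∸ suc j)) [mod p ]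
    coeff-R n = trans (B-mul-coeff (j * α) z<s (E p j) n)
      (≡mod-+ {a = coeff (E p j) n} (coeff-mod (bv 1 j n))
        (guard-≡mod (suc j) n (≡mod-* {a = j * α} refl (coeff-mod (bv 1 j (n ∸ suc j))))))
    below : ∀ n → n < j → coeff L n ≡ coeff R n [mod p ]
    below n n<j = trans (compose-E-coeff 0<j z n) (trans
      (cong (λ x → (δ 0 1 n + x) % p) (guard-no _ n<j))
      (sym (trans (coeff-R n) (cong₂ (λ x y → (x + y) % p) (bv-low 1 n<j) (guard-no _ (m<n⇒m<1+n n<j))))))
    at-j : coeff L j ≡ coeff R j [mod p ]
    at-j = trans (compose-E-coeff 0<j z j) (trans
      (cong₂ (λ x y → (x + y) % p) (δ-off 1 (<⇒≢ 0<j ∘ sym))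
        (trans (guard-yes {j} {j} _ ≤-refl) (trans (cong (coeff (pow p z j)) (n∸n≡0 j)) (pow-InU1 j z∈U))))
      (sym (trans (coeff-R j) (cong₂ (λ x y → (x + y) % p) (bv-top 1 0<j) (guard-no _ (n<1+n j))))))
    -- both coefficients of t^(j+1) are j α
    at-j+1 : coeff L (suc j) ≡ coeff R (suc j) [mod p ]
    at-j+1 = trans (compose-E-coeff 0<j z (suc j)) (trans
      (cong (λ x → x % p) (guard-yes {j} {suc j} _ (n≤1+n j)))
      (trans (cong (λ i → coeff (pow p z j) i % p) (m+n∸n≡m 1 j)) (trans (pow-coeff-1 j z∈U)
      (sym (trans (coeff-R (suc j)) (cong₂ (λ x y → (x + y) % p) (bv-mid 1 z<s (<⇒≢ (n<1+n j) ∘ sym))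
        (trans (guard-yes {suc j} {suc j} _ ≤-refl)
               (trans (cong (λ i → j * α * bv 1 j i) (n∸n≡0 (suc j))) (*-identityʳ (j * α))))))))))
    coeffs : ∀ n → n < 2 + j → coeff L n ≡ coeff R n [mod p ]
    coeffs n n<2+j with <-cmp n j
    ... | tri< n<j _ _ = below n n<j
    ... | tri≈ _ n≡j _ = subst (λ i → coeff L i ≡ coeff R i [mod p ]) (sym n≡j) at-j
    ... | tri> _ _ j<n = subst (λ i → coeff L i ≡ coeff R i [mod p ]) (≤-antisym j<n (≤-pred n<2+j)) at-j+1

  compose-E-Agree-E : ∀ {z} → InU1 z → ∀ {j} → 0 < j → Agree (suc j) (compose p (E p j) z) (E p j)
  compose-E-Agree-E {z} z∈U {j} 0<j = Agree-trans (Agree-weaken (n≤1+n (suc j)) (compose-E-Agree z∈U 0<j))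
    (Agree-trans (mul-Agree (suc j) {g = E p j} {g′ = E p j} (B-Agree-one (j * coeff z 1) (suc j)) (λ _ _ → refl))
                 (≐⇒Agree (one-mul (E p j))))

  B-Agree-pow-E : ∀ c {n} → 0 < n → Agree (suc n) (B c n) (pow p (E p n) c)
  B-Agree-pow-E c {n} 0<n = Agree-sym (Agree-trans (pow-B-Agree 1 0<n c) (≐⇒Agree (B-cong n (cong (_% p) (*-identityʳ c)))))

  pow-E-Agree : ∀ {n} → 0 < n → Agree (suc (p * n)) (pow p (E p n) p) (E p (p * n))
  pow-E-Agree {n} 0<n = Agree-trans (frobenius 1 0<n) (≐⇒Agree (B-cong (p * n) (cong (_% p) (^-zeroˡ p))))

  -- Division by a unit g ∈ U₁: the quotient w = f / g has coefficients
  --   w₀ = f₀,   w_(n+1) = f_(n+1) - Σ_(i ≤ n) g_(i+1) w_(n-i),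
  -- computed through a table whose n-th row holds w₀, …, wₙ.
  module Division (f g : Series p) (g∈U : InU1 g) where

    tail-sum : (ℕ → Fin p) → ℕ → ℕ
    tail-sum v n = Σ≤ n (λ i → coeff g (suc i) * toℕ (v (n ∸ i)))

    next : (ℕ → Fin p) → ℕ → Fin p
    next v n = (coeff f (suc n) + (p ∸ tail-sum v n % p)) mod p

    table : ℕ → ℕ → Fin p
    table zero    _ = f 0
    table (suc n) i = if i ≤ᵇ n then table n i else next (table n) n

    w : Series p
    w i = table i i

    table-stable : ∀ n i → i ≤ n → table n i ≡ w i
    table-stable zero    zero z≤n = refl
    table-stable (suc n) i i≤1+n with i ≟ suc n
    ... | yes refl = refl
    ... | no i≢1+n with i ≤ᵇ n | ≤⇒≤ᵇ (≤-pred (≤∧≢⇒< i≤1+n i≢1+n))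
    ...   | true | _ = table-stable n i (≤-pred (≤∧≢⇒< i≤1+n i≢1+n))

    w-suc : ∀ n → w (suc n) ≡ next w n
    w-suc n with suc n ≤ᵇ n in eq
    ... | true  = ⊥-elim (1+n≰n (≤ᵇ⇒≤ (suc n) n (subst T (sym eq) tt)))
    ... | false = cong (λ x → (coeff f (suc n) + (p ∸ x % p)) mod p)
                       (Σ-cong n (λ i _ → cong (λ y → coeff g (suc i) * toℕ y) (table-stable n (n ∸ i) (m∸n≤m n i))))

    -- (g w)_(n+1) = w_(n+1) + Σ_(i ≤ n) g_(i+1) w_(n-i), as g₀ = 1
    mul-coeff-suc : ∀ n → coeff (mul p g w) (suc n) ≡ coeff w (suc n) + tail-sum w n [mod p ]
    mul-coeff-suc n = trans (coeff-mod _) (cong (_% p) (trans (Σ-first n _)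
      (cong (_+ tail-sum w n) (trans (cong (_* coeff w (suc n)) g∈U) (*-identityˡ _)))))

    w-mul : mul p g w ≐ f
    w-mul zero = ≡mod⇒≡ (trans (coeff-mod _) (cong (_% p) (trans (cong (_* coeff f 0) g∈U) (*-identityˡ _))))
    w-mul (suc n) = ≡mod⇒≡ (trans (mul-coeff-suc n) (begin
      (toℕ (w (suc n)) + S) % p                  ≡⟨ cong (λ x → (toℕ x + S) % p) (w-suc n) ⟩
      (toℕ ((F + (p ∸ S % p)) mod p) + S) % p
        ≡⟨ ≡mod-+ {a = toℕ ((F + (p ∸ S % p)) mod p)} {b = S} (coeff-mod _) (sym (%-≡mod S)) ⟩
      (F + (p ∸ S % p) + S % p) % p
        ≡⟨ cong (_% p) (trans (+-assoc F _ _) (cong (F +_) (m∸n+n≡m (m%n≤n S p)))) ⟩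
      (F + p) % p                                ≡⟨ [m+n]%n≡m%n F p ⟩
      F % p                                      ∎))
      where
      open ≡-Reasoning
      F S : ℕ
      F = coeff f (suc n)
      S = tail-sum w n

    -- if f ≡ g (mod tᵇ), then w ≡ 1 (mod t^(n+1)) for all n < b, by induction on n:
    -- comparing (g w)_(n+1) = f_(n+1) = g_(n+1) with (g w)_(n+1) = w_(n+1) + g_(n+1)
    w-Agree : InU1 f → ∀ b → Agree b f g → ∀ n → n < b → Agree (suc n) w (one p)
    w-Agree f∈U b f≡g zero _ = Agree-extend (λ _ ()) (toℕ-injective (trans f∈U (sym coeff-one-0)))
    w-Agree f∈U b f≡g (suc n) n+1<b = Agree-extend w≡1 (≡mod⇒≡
      (≡mod-+-cancelʳ {a = wₙ₊₁} {b = coeff (one p) (suc n)} {c = gₙ₊₁} (begin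
      (wₙ₊₁ + gₙ₊₁) % p                     ≡⟨ cong (λ x → (wₙ₊₁ + x) % p) tail≡gₙ₊₁ ⟨
      (wₙ₊₁ + tail-sum w n) % p             ≡⟨ mul-coeff-suc n ⟨
      coeff (mul p g w) (suc n) % p         ≡⟨ cong (λ x → toℕ x % p) (trans (w-mul (suc n)) (f≡g (suc n) n+1<b)) ⟩
      gₙ₊₁ % p                              ≡⟨ cong (λ x → (x + gₙ₊₁) % p) (coeff-one-suc n) ⟨
      (coeff (one p) (suc n) + gₙ₊₁) % p    ∎)))
      where
      open ≡-Reasoning
      wₙ₊₁ gₙ₊₁ : ℕ
      wₙ₊₁ = coeff w (suc n)
      gₙ₊₁ = coeff g (suc n)
      w≡1 : Agree (suc n) w (one p)
      w≡1 = w-Agree f∈U b f≡g n (<-trans (n<1+n n) n+1<b)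
      -- only the term i = n survives, as w₀ = 1 and w_(n-i) = 0 for i < n
      tail≡gₙ₊₁ : tail-sum w n ≡ coeff g (suc n)
      tail≡gₙ₊₁ = trans (Σ-single n n ≤-refl (λ i i≤n i≢n → trans
          (cong (λ x → coeff g (suc i) * toℕ x) (w≡1 (n ∸ i) (s≤s (m∸n≤m n i))))
          (trans (cong (coeff g (suc i) *_) (coeff-one-pos (m<n⇒0<n∸m (≤∧≢⇒< i≤n i≢n)))) (*-zeroʳ (coeff g (suc i))))))
        (trans (cong (λ x → coeff g (suc n) * toℕ x) (trans (cong w (n∸n≡0 n)) (w≡1 0 z<s)))
               (trans (cong (coeff g (suc n) *_) coeff-one-0) (*-identityʳ _)))
        where
        coeff-one-pos : ∀ {k} → 0 < k → coeff (one p) k ≡ 0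
        coeff-one-pos {suc k} _ = coeff-one-suc k

  factor : ∀ {f g} b → 1 ≤ b → InU1 f → InU1 g → Agree b f g → ∃ λ w → InU b w × mul p g w ≐ f
  factor {f} {g} (suc b) 1≤b f∈U g∈U f≡g =
    w , Agree⇒InU 1≤b (w-Agree f∈U (suc b) f≡g b ≤-refl) , w-mul
    where open Division f g g∈U

module Character {p : ℕ} (isPrime : Prime p) (χ : Series p → ℕ) (m : ℕ)
                 (χ-type : IsType2m p {{prime⇒nonZero isPrime}} χ m) where

  open Primes isPrime
  open PowerSeries isPrime

  χ-hom : IsHom p χ
  χ-hom = proj₁ χ-type

  χ-continuous : IsContinuous p χ
  χ-continuous = proj₁ (proj₂ χ-type)

  break₀ : IsBreak p χ 0 2
  break₀ = proj₁ (proj₂ (proj₂ (proj₂ χ-type)))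

  break₁ : IsBreak p χ 1 m
  break₁ = proj₂ (proj₂ (proj₂ (proj₂ χ-type)))

  χ-mul : ∀ {f g} → InU1 f → InU1 g → χ (mul p f g) ≡ χ f + χ g [mod p ^ 2 ]
  χ-mul f∈U g∈U = Cong⇒≡mod (χ-hom _ _ f∈U g∈U)

  χ-≐ : ∀ {f g} → InU1 f → InU1 g → f ≐ g → χ f ≡ χ g [mod p ^ 2 ]
  χ-≐ f∈U g∈U f≡g = Cong⇒≡mod (proj₂ χ-continuous _ _ f∈U g∈U (λ i _ → f≡g i))

  -- χ(1) = 0 as χ(1) = χ(1 · 1) = 2 χ(1), hence χ(fᵏ) = k χ(f)
  χ-one : χ (one p) ≡ 0 [mod p ^ 2 ]
  χ-one = sym (≡mod-+-cancelʳ {a = 0} {b = χ (one p)} {c = χ (one p)}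
    (trans (sym (χ-≐ 1·1∈U coeff-one-0 (one-mul (one p)))) (χ-mul coeff-one-0 coeff-one-0)))
    where
    1·1∈U : InU1 (mul p (one p) (one p))
    1·1∈U = mul-InU1 {one p} {one p} coeff-one-0 coeff-one-0

  χ-pow : ∀ {f} k → InU1 f → χ (pow p f k) ≡ k * χ f [mod p ^ 2 ]
  χ-pow zero    _   = χ-one
  χ-pow {f} (suc k) f∈U = trans (χ-mul (pow-InU1 k f∈U) f∈U)
    (trans (≡mod-+ {a = χ (pow p f k)} {b = χ f} (χ-pow k f∈U) refl) (cong (_% p ^ 2) (+-comm (k * χ f) (χ f))))

  -- b⁽¹⁾ = m: χ vanishes on 1 + 𝔐^(m+1), since otherwise a power of w would have value p
  χ-vanishes : ∀ {w} → InU (suc m) w → χ w ≡ 0 [mod p ^ 2 ]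
  χ-vanishes {w} w∈U with χ w % p ^ 2 ≟ 0 % p ^ 2
  ... | yes χw≡0 = χw≡0
  ... | no χw≢0 = let u , uχw≡p = multiple-≡p χw≢0 in
    ⊥-elim (proj₂ break₁ (suc m) ≤-refl (pow p w u , pow-InU u (s≤s z≤n) w∈U ,
      ≡mod⇒Cong (trans (χ-pow u (InU⇒InU1 w∈U)) (trans uχw≡p (cong (_% p ^ 2) (sym (*-identityʳ p)))))))

  -- b⁽⁰⁾ = 2: χ(1 + 𝔐³) ⊆ p ℤ/p²ℤ, since otherwise a power of w would have value 1
  χ-divisible : ∀ {w} → InU 3 w → χ w ≡ 0 [mod p ]
  χ-divisible {w} w∈U with p ∣? χ w
  ... | yes (divides q χw≡qp) = trans (cong (_% p) χw≡qp) (multiple-≡mod-0 q)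
  ... | no p∤χw = let u , uχw≡1 = inverse-mod-p² p∤χw in
    ⊥-elim (proj₂ break₀ 3 ≤-refl (pow p w u , pow-InU u (s≤s z≤n) w∈U ,
      ≡mod⇒Cong (trans (χ-pow u (InU⇒InU1 w∈U)) uχw≡1)))

  χ-Agree : ∀ {f g} → InU1 f → InU1 g → Agree (suc m) f g → χ f ≡ χ g [mod p ^ 2 ]
  χ-Agree {f} {g} f∈U g∈U f≡g = let w , w∈U , gw≡f = factor (suc m) (s≤s z≤n) f∈U g∈U f≡g in begin
    χ f % p ^ 2               ≡⟨ χ-≐ f∈U (mul-InU1 {g} {w} g∈U (InU⇒InU1 w∈U)) (λ i → sym (gw≡f i)) ⟩
    χ (mul p g w) % p ^ 2     ≡⟨ χ-mul g∈U (InU⇒InU1 w∈U) ⟩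
    (χ g + χ w) % p ^ 2       ≡⟨ ≡mod-+ {a = χ g} refl (χ-vanishes w∈U) ⟩
    (χ g + 0) % p ^ 2         ≡⟨ cong (_% p ^ 2) (+-identityʳ (χ g)) ⟩
    χ g % p ^ 2               ∎
    where open ≡-Reasoning

  χ-Agree₃ : ∀ {f g} → InU1 f → InU1 g → Agree 3 f g → χ f ≡ χ g [mod p ]
  χ-Agree₃ {f} {g} f∈U g∈U f≡g = let w , w∈U , gw≡f = factor 3 (s≤s z≤n) f∈U g∈U f≡g in begin
    χ f % p
      ≡⟨ ≡mod-∣ p (p∣p²) (χ-≐ f∈U (mul-InU1 {g} {w} g∈U (InU⇒InU1 w∈U)) (λ i → sym (gw≡f i))) ⟩
    χ (mul p g w) % p         ≡⟨ ≡mod-∣ p (p∣p²) (χ-mul g∈U (InU⇒InU1 w∈U)) ⟩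
    (χ g + χ w) % p           ≡⟨ ≡mod-+ {a = χ g} refl (χ-divisible w∈U) ⟩
    (χ g + 0) % p             ≡⟨ cong (_% p) (+-identityʳ (χ g)) ⟩
    χ g % p                   ∎
    where open ≡-Reasoning

  -- the values of 1 + c tᵐ and 1 + c t², as those of E_mᶜ and E₂ᶜ
  χ-B : ∀ c → 0 < m → χ (B c m) ≡ c * χ (E p m) [mod p ^ 2 ]
  χ-B c 0<m = trans (χ-Agree (B-InU1 c m) (pow-InU1 c (B-InU1 1 m)) (B-Agree-pow-E c 0<m)) (χ-pow c (B-InU1 1 m))

  χ-B₂ : ∀ c → χ (B c 2) ≡ c * χ (E p 2) [mod p ]
  χ-B₂ c = trans (χ-Agree₃ (B-InU1 c 2) (pow-InU1 c (B-InU1 1 2)) (B-Agree-pow-E c z<s))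
                 (≡mod-∣ p p∣p² (χ-pow c (B-InU1 1 2)))

  -- if χ(E₂) is a unit modulo p, then m ≥ 2p: a power of E₂ᵖ ∈ 1 + 𝔐^(2p) has value p
  unit-χE₂⇒2p≤m : ¬ p ∣ χ (E p 2) → p * 2 ≤ m
  unit-χE₂⇒2p≤m p∤χE₂ with m <? p * 2
  ... | no m≮2p = ≮⇒≥ m≮2p
  ... | yes m<2p = let u , uχE₂≡1 = inverse (∤⇒coprime p∤χE₂) in
    ⊥-elim (proj₂ break₁ (p * 2) m<2p (pow p F u , pow-InU u 1≤2p F∈U , ≡mod⇒Cong (begin
      χ (pow p F u) % p ^ 2          ≡⟨ χ-pow u (InU⇒InU1 F∈U) ⟩
      (u * χ F) % p ^ 2              ≡⟨ ≡mod-* {a = u} refl (χ-pow p (B-InU1 1 2)) ⟩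
      (u * (p * χ (E p 2))) % p ^ 2  ≡⟨ cong (_% p ^ 2) (u[pv]≡p[uv] u (χ (E p 2))) ⟩
      (p * (u * χ (E p 2))) % p ^ 2  ≡⟨ p·unit uχE₂≡1 ⟩
      p % p ^ 2                      ≡⟨ cong (_% p ^ 2) (*-identityʳ p) ⟨
      (p * 1) % p ^ 2                ∎)))
    where
    F : Series p
    F = pow p (E p 2) p
    1≤2p : 1 ≤ p * 2
    1≤2p = ≤-trans (<⇒≤ 1<p) (m≤m*n p 2)
    F∈U : InU (p * 2) F
    F∈U = Agree⇒InU 1≤2p (Agree-trans (Agree-weaken (n≤1+n (p * 2)) (frobenius 1 z<s)) (B-Agree-one (1 ^ p) (p * 2)))
    open ≡-Reasoning
    u[pv]≡p[uv] : ∀ u v → u * (p * v) ≡ p * (u * v)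
    u[pv]≡p[uv] u v = trans (sym (*-assoc u p v)) (trans (cong (_* v) (*-comm u p)) (*-assoc p u v))

  -- m ≠ p D for D ≥ 3: the break witness z ∈ 1 + 𝔐ᵐ with χ(z) = p would satisfy
  -- z ≡ 1 + c tᵐ ≡ (E_Dᵖ)ᶜ (mod t^(m+1)), so χ(z) ≡ c p χ(E_D) ≡ 0 since E_D ∈ 1 + 𝔐³
  m≢p*D : ∀ D → 3 ≤ D → m ≢ p * D
  m≢p*D D 3≤D m≡pD = p≢0[mod-p²] (begin
      p % p ^ 2                 ≡⟨ cong (_% p ^ 2) (*-identityʳ p) ⟨
      (p * 1) % p ^ 2           ≡⟨ Cong⇒≡mod χz≡p ⟨
      χ z % p ^ 2               ≡⟨ χz≡0 ⟩
      0 % p ^ 2                 ∎)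
    where
    open ≡-Reasoning
    0<D : 0 < D
    0<D = ≤-trans (s≤s z≤n) 3≤D
    0<m : 0 < m
    0<m = subst (0 <_) (sym m≡pD) (≤-trans 0<D (m≤n*m D p))
    z : Series p
    z = proj₁ (proj₁ break₁)
    z∈U : InU m z
    z∈U = proj₁ (proj₂ (proj₁ break₁))
    χz≡p : Cong (p ^ 2) (χ z) (p ^ 1)
    χz≡p = proj₂ (proj₂ (proj₁ break₁))
    c : ℕ
    c = coeff z m
    z≈B : Agree (suc m) z (B c m)
    z≈B = Agree-extend (Agree-trans (InU⇒Agree z∈U) (Agree-sym (B-Agree-one c m)))
                       (≡mod⇒≡ (sym (coeff-B-top c 0<m)))
    Eₘ≈E_Dᵖ : Agree (suc m) (E p m) (pow p (E p D) p)
    Eₘ≈E_Dᵖ = subst (λ n → Agree (suc n) (E p n) (pow p (E p D) p)) (sym m≡pD) (Agree-sym (pow-E-Agree 0<D))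
    E_D∈U₃ : InU 3 (E p D)
    E_D∈U₃ = Agree⇒InU (s≤s z≤n) (Agree-weaken 3≤D (B-Agree-one 1 D))
    χz≡0 : χ z ≡ 0 [mod p ^ 2 ]
    χz≡0 = begin
      χ z % p ^ 2                         ≡⟨ χ-Agree (InU⇒InU1 z∈U) (B-InU1 c m) z≈B ⟩
      χ (B c m) % p ^ 2                   ≡⟨ χ-B c 0<m ⟩
      (c * χ (E p m)) % p ^ 2
        ≡⟨ ≡mod-* {a = c} refl (χ-Agree (B-InU1 1 m) (pow-InU1 p (B-InU1 1 D)) Eₘ≈E_Dᵖ) ⟩
      (c * χ (pow p (E p D) p)) % p ^ 2   ≡⟨ ≡mod-* {a = c} refl (χ-pow p (B-InU1 1 D)) ⟩
      (c * (p * χ (E p D))) % p ^ 2       ≡⟨ ≡mod-* {a = c} refl (scale-by-p (χ-divisible E_D∈U₃)) ⟩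
      (c * (p * 0)) % p ^ 2               ≡⟨ cong (λ x → (c * x) % p ^ 2) (*-zeroʳ p) ⟩
      (c * 0) % p ^ 2                     ≡⟨ cong (_% p ^ 2) (*-zeroʳ c) ⟩
      0 % p ^ 2                           ∎

module Parts {p : ℕ} (isPrime : Prime p) (χ : Series p → ℕ) (m x₁ x₂ : ℕ) (a : ℕ → ℕ)
  (χ-type : IsType2m p {{prime⇒nonZero isPrime}} χ m)
  (expansion : StdExpansion p {{prime⇒nonZero isPrime}} χ m x₁ x₂ a)
  (z : Series p) (z∈U : InU1 z) where

  open Primes isPrime
  open PowerSeries isPrime
  open Character isPrime χ m χ-type

  x₂<p : x₂ < p
  x₂<p = proj₁ (proj₂ expansion)

  x₂≢0 : x₂ ≢ 0
  x₂≢0 = proj₁ (proj₂ (proj₂ (proj₂ expansion)))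

  χE₁≡ : Cong (p ^ 2) (χ (E p 1)) (x₁ + p * a 1)
  χE₁≡ = proj₁ (proj₂ (proj₂ (proj₂ (proj₂ (proj₂ expansion)))))

  χE₂≡ : Cong (p ^ 2) (χ (E p 2)) (x₂ + p * a 2)
  χE₂≡ = proj₁ (proj₂ (proj₂ (proj₂ (proj₂ (proj₂ (proj₂ expansion))))))

  χEⱼ≡ : ∀ j → 3 ≤ j → j ≤ m → ¬ (p ∣ j) → Cong (p ^ 2) (χ (E p j)) (p * a j)
  χEⱼ≡ = proj₁ (proj₂ (proj₂ (proj₂ (proj₂ (proj₂ (proj₂ (proj₂ expansion)))))))

  mod-p : ∀ {v} x k → v ≡ x + p * k [mod p ^ 2 ] → v ≡ x [mod p ]
  mod-p {v} x k v≡x+pk = trans (≡mod-∣ p p∣p² v≡x+pk)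
    (trans (cong (λ y → (x + y) % p) (*-comm p k)) ([m+kn]%n≡m%n x k p))

  χE₁ : χ (E p 1) ≡ x₁ [mod p ]
  χE₁ = mod-p x₁ (a 1) (Cong⇒≡mod χE₁≡)

  χE₂ : χ (E p 2) ≡ x₂ [mod p ]
  χE₂ = mod-p x₂ (a 2) (Cong⇒≡mod χE₂≡)

  -- χ(E₂) ≡ x₂ is a unit modulo p, hence m ≥ 2p (so m ≥ 4)
  p∤χE₂ : ¬ p ∣ χ (E p 2)
  p∤χE₂ p∣χE₂ = x₂≢0 (trans (sym (m<n⇒m%n≡m x₂<p)) (trans (sym χE₂) (n∣m⇒m%n≡0 _ p p∣χE₂)))

  2p≤m : p * 2 ≤ m
  2p≤m = unit-χE₂⇒2p≤m p∤χE₂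

  4≤m : 4 ≤ m
  4≤m = ≤-trans (*-monoˡ-≤ 2 1<p) 2p≤m

  -- if p ∣ m then m = 2p: m = q p with q ≥ 2, and q ≥ 3 is excluded by m≢p*D
  m≡2p : p ∣ m → m ≡ p * 2
  m≡2p (divides q m≡qp) = from-quotient q (*-cancelʳ-≤ 2 q p (subst₂ _≤_ (*-comm p 2) m≡qp 2p≤m)) m≡qp
    where
    from-quotient : ∀ q → 2 ≤ q → m ≡ q * p → m ≡ p * 2
    from-quotient 0 () _
    from-quotient 1 (s≤s ()) _
    from-quotient 2 _ m≡2p = trans m≡2p (*-comm 2 p)
    from-quotient (suc (suc (suc r))) _ m≡qp = ⊥-elim (m≢p*D (3 + r) (s≤s (s≤s (s≤s z≤n))) (trans m≡qp (*-comm (3 + r) p)))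

  α : ℕ
  α = coeff z 1

  Eᵤ : ℕ → Series p
  Eᵤ j = compose p (E p j) z

  -- (a): by the shift lemma for j = 1, E₁(u) ≡ (1 + α t²) E₁ (mod t³), and
  -- χ(1 + α t²) ≡ α χ(E₂) (mod p); for j = 2, E₂(u) ≡ E₂ (mod t³)
  part-a₁ : χ (Eᵤ 1) ≡ x₁ + α * x₂ [mod p ]
  part-a₁ = begin
    χ (Eᵤ 1) % p
      ≡⟨ χ-Agree₃ (compose-E-InU1 {1} z<s z) Q·E₁∈U (compose-E-Agree z∈U {1} z<s) ⟩
    χ (mul p (B (1 * α) 2) (E p 1)) % p   ≡⟨ ≡mod-∣ p p∣p² (χ-mul (B-InU1 (1 * α) 2) (B-InU1 1 1)) ⟩
    (χ (B (1 * α) 2) + χ (E p 1)) % p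
      ≡⟨ ≡mod-+ {a = χ (B (1 * α) 2)} (trans (χ-B₂ (1 * α)) (≡mod-* {a = 1 * α} refl χE₂)) χE₁ ⟩
    (1 * α * x₂ + x₁) % p
      ≡⟨ cong (_% p) (trans (+-comm (1 * α * x₂) x₁) (cong (λ c → x₁ + c * x₂) (*-identityˡ α))) ⟩
    (x₁ + α * x₂) % p                     ∎
    where
    open ≡-Reasoning
    Q·E₁∈U : InU1 (mul p (B (1 * α) 2) (E p 1))
    Q·E₁∈U = mul-InU1 {B (1 * α) 2} {E p 1} (B-InU1 (1 * α) 2) (B-InU1 1 1)

  part-a₂ : χ (Eᵤ 2) ≡ x₂ [mod p ]
  part-a₂ = trans (χ-Agree₃ (compose-E-InU1 {2} z<s z) (B-InU1 1 2) (compose-E-Agree-E z∈U {2} z<s)) χE₂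

  0<m : 0 < m
  0<m = ≤-trans (s≤s z≤n) 4≤m

  3≤m : 3 ≤ m
  3≤m = ≤-trans (n≤1+n 3) 4≤m

  3≤m-1 : 3 ≤ m ∸ 1
  3≤m-1 = ∸-monoˡ-≤ 1 4≤m

  [m-1]+1≡m : m ∸ 1 + 1 ≡ m
  [m-1]+1≡m = m∸n+n≡m 0<m

  -- (b): Eₘ(u) ≡ Eₘ (mod t^(m+1))
  part-b : ¬ p ∣ m → χ (Eᵤ m) ≡ p * a m [mod p ^ 2 ]
  part-b p∤m = trans (χ-Agree (compose-E-InU1 0<m z) (B-InU1 1 m) (compose-E-Agree-E z∈U 0<m))
                     (Cong⇒≡mod (χEⱼ≡ m 3≤m ≤-refl p∤m))

  -- the coefficient j α of the shift lemma for j = m - 1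
  c₀ : ℕ
  c₀ = (m ∸ 1) * α

  -- the shift lemma for j = m - 1:  E_(m-1)(u) ≡ (1 + c₀ tᵐ) E_(m-1)  (mod t^(m+1))
  χEᵤ[m-1] : χ (Eᵤ (m ∸ 1)) ≡ χ (B c₀ m) + χ (E p (m ∸ 1)) [mod p ^ 2 ]
  χEᵤ[m-1] = trans (χ-Agree (compose-E-InU1 0<m-1 z) (mul-InU1 {B c₀ m} {E p (m ∸ 1)} (B-InU1 c₀ m) (B-InU1 1 (m ∸ 1))) shift)
                   (χ-mul (B-InU1 c₀ m) (B-InU1 1 (m ∸ 1)))
    where
    0<m-1 : 0 < m ∸ 1
    0<m-1 = ≤-trans (s≤s z≤n) 3≤m-1
    shift : Agree (suc m) (Eᵤ (m ∸ 1)) (mul p (B c₀ m) (E p (m ∸ 1)))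
    shift = subst (λ n → Agree (suc n) (Eᵤ (m ∸ 1)) (mul p (B c₀ n) (E p (m ∸ 1))))
                  (trans (+-comm 1 (m ∸ 1)) [m-1]+1≡m) (compose-E-Agree z∈U 0<m-1)

  χEₘ₋₁ : ¬ p ∣ (m ∸ 1) → χ (E p (m ∸ 1)) ≡ p * a (m ∸ 1) [mod p ^ 2 ]
  χEₘ₋₁ p∤m-1 = Cong⇒≡mod (χEⱼ≡ (m ∸ 1) 3≤m-1 (m∸n≤m m 1) p∤m-1)

  -- (c): χ(1 + c₀ tᵐ) ≡ c₀ χ(Eₘ) = c₀ p aₘ
  part-c : ¬ p ∣ m → ¬ p ∣ (m ∸ 1) → χ (Eᵤ (m ∸ 1)) ≡ p * (a (m ∸ 1) + (m ∸ 1) * α * a m) [mod p ^ 2 ]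
  part-c p∤m p∤m-1 = begin
    χ (Eᵤ (m ∸ 1)) % p ^ 2                          ≡⟨ χEᵤ[m-1] ⟩
    (χ (B c₀ m) + χ (E p (m ∸ 1))) % p ^ 2          ≡⟨ ≡mod-+ {a = χ (B c₀ m)} χB (χEₘ₋₁ p∤m-1) ⟩
    (c₀ * (p * a m) + p * a (m ∸ 1)) % p ^ 2
      ≡⟨ cong (_% p ^ 2) (solve 4 (λ c p x y → c :* (p :* x) :+ p :* y := p :* (y :+ c :* x)) refl c₀ p (a m) (a (m ∸ 1))) ⟩
    (p * (a (m ∸ 1) + c₀ * a m)) % p ^ 2            ∎
    where
    open ≡-Reasoning
    open +-*-Solver
    χB : χ (B c₀ m) ≡ c₀ * (p * a m) [mod p ^ 2 ]
    χB = trans (χ-B c₀ 0<m) (≡mod-* {a = c₀} refl (Cong⇒≡mod (χEⱼ≡ m 3≤m ≤-refl p∤m)))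

  -- (d): m = 2p and c₀ ≡ ηᵖ, so 1 + c₀ tᵐ ≡ (1 + η t²)ᵖ has value p χ(1 + η t²) ≡ p η x₂
  part-d : p ∣ m → ∀ η → Cong p (η ^ p) ((m ∸ 1) * α) → χ (Eᵤ (m ∸ 1)) ≡ p * (a (m ∸ 1) + η * x₂) [mod p ^ 2 ]
  part-d p∣m η ηᵖ≡c₀ = begin
    χ (Eᵤ (m ∸ 1)) % p ^ 2                          ≡⟨ χEᵤ[m-1] ⟩
    (χ (B c₀ m) + χ (E p (m ∸ 1))) % p ^ 2          ≡⟨ ≡mod-+ {a = χ (B c₀ m)} χB (χEₘ₋₁ p∤m-1) ⟩
    (p * (η * x₂) + p * a (m ∸ 1)) % p ^ 2
      ≡⟨ cong (_% p ^ 2) (trans (+-comm (p * (η * x₂)) _) (sym (*-distribˡ-+ p (a (m ∸ 1)) (η * x₂)))) ⟩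
    (p * (a (m ∸ 1) + η * x₂)) % p ^ 2              ∎
    where
    open ≡-Reasoning
    -- p ∣ m and p ∣ m - 1 would give p ∣ 1
    p∤m-1 : ¬ p ∣ (m ∸ 1)
    p∤m-1 p∣m-1 = <⇒≢ 1<p (sym (∣1⇒≡1 (∣m+n∣m⇒∣n (subst (p ∣_) (sym [m-1]+1≡m) p∣m) p∣m-1)))
    -- 1 + c₀ tᵐ = 1 + ηᵖ t^(2p) ≡ (1 + η t²)ᵖ  (mod t^(2p+1)), by Frobenius
    B≈Frob : Agree (suc m) (B c₀ m) (pow p (B η 2) p)
    B≈Frob = subst (λ n → Agree (suc n) (B c₀ n) (pow p (B η 2) p)) (sym (m≡2p p∣m))
      (Agree-trans (≐⇒Agree (B-cong (p * 2) (sym (Cong⇒≡mod ηᵖ≡c₀)))) (Agree-sym (frobenius η z<s)))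
    χB : χ (B c₀ m) ≡ p * (η * x₂) [mod p ^ 2 ]
    χB = trans (χ-Agree (B-InU1 c₀ m) (pow-InU1 p (B-InU1 η 2)) B≈Frob)
        (trans (χ-pow p (B-InU1 η 2)) (scale-by-p (trans (χ-B₂ η) (≡mod-* {a = η} refl χE₂))))

lemma5p1 : (p : ℕ) .{{_ : NonZero p}} → Prime p →
    (χ : Series p → ℕ) (m x₁ x₂ : ℕ) (a : ℕ → ℕ) →
    IsType2m p χ m → StdExpansion p χ m x₁ x₂ a →
    (z : Series p) → InU1 z →
    let α = toℕ (z 1)
        uχ = λ j → χ (compose p (E p j) z)
    in (Cong p (uχ 1) (x₁ + α * x₂) × Cong p (uχ 2) x₂)
     × (¬ (p ∣ m) → Cong (p ^ 2) (uχ m) (p * a m))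
     × (¬ (p ∣ m) → ¬ (p ∣ (m ∸ 1)) →
          Cong (p ^ 2) (uχ (m ∸ 1)) (p * (a (m ∸ 1) + (m ∸ 1) * α * a m)))
     × (p ∣ m → (η : ℕ) → η < p → Cong p (η ^ p) ((m ∸ 1) * α) →
          Cong (p ^ 2) (uχ (m ∸ 1)) (p * (a (m ∸ 1) + η * x₂)))
lemma5p1 p isPrime χ m x₁ x₂ a χ-type expansion z z∈U =
    (≡mod⇒Cong {{p≢0}} part-a₁ , ≡mod⇒Cong {{p≢0}} part-a₂)
  , (λ p∤m → ≡mod⇒Cong {{p²≢0}} (part-b p∤m))
  , (λ p∤m p∤m-1 → ≡mod⇒Cong {{p²≢0}} (part-c p∤m p∤m-1))
  , (λ p∣m η _ ηᵖ≡c₀ → ≡mod⇒Cong {{p²≢0}} (part-d p∣m η ηᵖ≡c₀))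
  where
  open Primes isPrime using (p≢0; p²≢0)
  open Parts isPrime χ m x₁ x₂ a χ-type expansion z z∈U
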